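{- Let $m$ be a positive integer, $x_1,\dots,x_m\in V$ pairwise distinct, $\varphi_1,\dots,\varphi_m\in E$, and assume $H[x_1:\varphi_1,\dots,x_m:\varphi_m]$. Let $k=k[x_1:\varphi_1,\dots,x_m:\varphi_m]$. Let $i\in\{1,\dots,m\}$ be such that $x_j\notin V_b(\varphi_i)$ for every $j=i,\dots,m$. Then $(\in)(x_i,\varphi_i)\in S(k)$, $\gamma[x_1:\varphi_1,\dots,x_m:\varphi_m,(\in)(x_i,\varphi_i)]\in S(\varepsilon)$, and $\#(\gamma[x_1:\varphi_1,\dots,x_m:\varphi_m,(\in)(x_i,\varphi_i)])$ is true.
   Context: Language $(V,F,C,\#)$: variables $V$; constants $C$ with meanings $\#(c)$; operator symbols $F$, each $f$ with applicability condition $A_f(x_1,\dots,x_n)$ and value $P_f(x_1,\dots,x_n)$ when applicable; auxiliary symbols $($, $)$, $,$, $:$, $\{\}$; all disjoint and uniquely readable; expressions are strings. $F$ contains $\wedge,\vee,\rightarrow,\leftrightarrow,\neg,\forall,\exists,\in,=$: $A_\wedge,A_\vee,A_\rightarrow,A_\leftrightarrow$ hold exactly on pairs each true or false, $P_\wedge=$ both true, $P_\vee=$ at least one true, $P_\rightarrow=$ "$x_1$ false or $x_2$ true", $P_\leftrightarrow(x_1,x_2)=P_\rightarrow(x_1,x_2)\wedge P_\rightarrow(x_2,x_1)$; $A_\neg$ holds on single objects, $P_\neg(x_1)=$ "$x_1$ false"; $A_\forall,A_\exists$ hold exactly on single sets whose elements are all true or false, $P_\forall=$ every element true, $P_\exists=$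 some element true; $A_\in$ holds exactly on pairs with $x_2$ a set, $P_\in=$ "$x_1\in x_2$"; $A_=$ holds on all pairs, $P_==$ "$x_1=x_2$". Soops: finite sequences of ordered pairs; $\varepsilon$ empty, $\|$ concatenation; $\mathrm{dom}$ = set of first components; $\alpha(a)=b$; $\alpha\sqsubseteq\gamma$: initial segment. Simultaneous induction on $n\ge1$: $K(1)=\{\varepsilon\}$, $\Xi(\varepsilon)=\{\varepsilon\}$, $E(1,\varepsilon)=C$, $\#(\varepsilon,c,\varepsilon)=\#(c)$, $V_b(c)=V_f(c)=\emptyset$. $K(n)^+$: all $h\|(y,\varphi)$, $h\in K(n)$, $\varphi\in E(n,h)$, $y\in V\setminus\mathrm{dom}(h)$, $\#(h,\varphi,\rho)$ a set for all $\rho$; $K(n+1)=K(n)\cup K(n)^+$; $\Xi(h\|(y,\varphi))=\{\rho\|(y,s):\rho\in\Xi(h),s\in\#(h,\varphi,\rho)\}$. $E(n+1,k)$ is the union of: (0) $E(n,k)$ if $k\in K(n)$; (a) for $k=h\|(y,\varphi)\in K(n)^+$, $t\in E(n,h)$ with $y\notin V_b(t)$, $\#(k,t,\rho\|(y,s))=\#(h,t,\rho)$; (b) for such $k$, $y$ itself, $\#(k,y,\sigma)=\sigma(y)$, $V_f(y)=\{y\}$, $V_b(y)=\emptyset$; (c) for $k\in K(n)$, $(\varphi)(\varphi_1,\dots,\varphi_m)$ with $\varphi,\varphi_i\in E(n,k)$, $\#(k,\varphi,\sigma)$ an $m$-ary function defined at $(\#(k,\varphi_i,\sigma))_i$ for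 all $\sigma$, meaning its value, $V_b,V_f$ unions; (d) for $k\in K(n)$, $(f)(\varphi_1,\dots,\varphi_m)$, $f\in F$, $\varphi_i\in E(n,k)$, $A_f(\#(k,\varphi_1,\sigma),\dots)$ for all $\sigma$, meaning $P_f(\dots)$, $V_b,V_f$ unions; (e) for $k\in K(n)$, $\{\}(x_1:\varphi_1,\dots,x_m:\varphi_m,\varphi)$, $x_i$ distinct in $V\setminus\mathrm{dom}(k)$, $k'_i=k\|(x_1,\varphi_1)\|\dots\|(x_i,\varphi_i)\in K(n)$, $\varphi_i\in E(n,k'_{i-1})$ with set meanings, $\varphi\in E(n,k'_m)$; meaning $\{\#(k'_m,\varphi,\sigma'):\sigma'\in\Xi(k'_m),\sigma\sqsubseteq\sigma'\}$; $V_b=\{x_1,\dots,x_m\}\cup\bigcup V_b(\varphi_i)\cup V_b(\varphi)$; $V_f=V_f(\varphi_1)\cup(V_f(\varphi_2)\setminus\{x_1\})\cup\dots\cup(V_f(\varphi)\setminus\{x_1,\dots,x_m\})$. $K=\bigcup K(n)$, $E(k)=\bigcup_nE(n,k)$, $E=\bigcup_kE(k)$; $S(k)$: $t\in E(k)$ with $\#(k,t,\sigma)$ true or false for all $\sigma\in\Xi(k)$; $\#(t)=\#(\varepsilon,t,\varepsilon)$. $H[x_1:\varphi_1,\dots,x_m:\varphi_m]$ means: with $k_0=\varepsilon$, $k_i=(x_1,\varphi_1)\|\dots\|(x_i,\varphi_i)$, for each $i=1..m$: $k_{i-1}\in K$, $\varphi_i\in E(k_{i-1})$, $\#(k_{i-1},\varphi_i,\rho)$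 a set for all $\rho\in\Xi(k_{i-1})$. Then $k[x_1:\varphi_1,\dots,x_m:\varphi_m]=k_m$. For $\varphi\in S(k_m)$: $\gamma[x_m:\varphi_m,\varphi]=(\forall)(\{\}(x_m:\varphi_m,\varphi))$, and $\gamma[x_{i-1}:\varphi_{i-1},\dots,x_m:\varphi_m,\varphi]=(\forall)(\{\}(x_{i-1}:\varphi_{i-1},\gamma[x_i:\varphi_i,\dots,x_m:\varphi_m,\varphi]))$ for $i=m,\dots,2$. -}

module Defs where

open import Level using (Level)
open import Data.Nat using (ℕ; zero; suc)
open import Data.List using (List; []; _∷_; _++_; _∷ʳ_; map)
open import Data.List.Membership.Propositional using (_∈_; _∉_)
open import Data.Product using (Σ; Σ-syntax; _×_; _,_; proj₁; proj₂)
open import Data.Sum using (_⊎_; inj₁; inj₂)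
open import Data.Empty using (⊥)
open import Relation.Nullary using (¬_)
open import Relation.Binary.PropositionalEquality using (_≡_; _≢_; refl)
open import Function.Bundles using (_⇔_)

-- The ambient (classical, ZF-with-urelements style) universe of objects
-- in which meanings live.  Objects may be sets, the truth values true /
-- false, functions, or other things (urelements).

record Universe : Set₁ where
  field
    Obj    : Set
    _∈ₒ_   : Obj → Obj → Set
    IsSet  : Obj → Set
    true   : Obj
    false  : Obj
    true≢false : true ≢ false
    -- "f is an m-ary function (m = length xs) defined at the tuple xs"
    FunDefinedAt : Obj → List Obj → Set
    apply  : Obj → List Obj → Obj
    -- set-theoretic axioms (sets are extensional; Agda predicates serve
    -- as formulas in separation / replacement)
    extensionality : ∀ a b → IsSet a → IsSet b →
                     (∀ z → (z ∈ₒ a) ⇔ (z ∈ₒ b)) → a ≡ b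
    emptySet   : Σ[ e ∈ Obj ] (IsSet e × (∀ z → ¬ (z ∈ₒ e)))
    pairing    : ∀ a b → Σ[ c ∈ Obj ] (IsSet c × (∀ z → (z ∈ₒ c) ⇔ (z ≡ a ⊎ z ≡ b)))
    union      : ∀ a → IsSet a →
                 Σ[ c ∈ Obj ] (IsSet c × (∀ z → (z ∈ₒ c) ⇔ (Σ[ w ∈ Obj ] (w ∈ₒ a × z ∈ₒ w))))
    powerSet   : ∀ a → IsSet a →
                 Σ[ c ∈ Obj ] (IsSet c × (∀ z → (z ∈ₒ c) ⇔ (IsSet z × (∀ w → w ∈ₒ z → w ∈ₒ a))))
    separation : ∀ a (Q : Obj → Set) → IsSet a →
                 Σ[ c ∈ Obj ] (IsSet c × (∀ z → (z ∈ₒ c) ⇔ (z ∈ₒ a × Q z)))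
    replacement : ∀ a (R : Obj → Obj → Set) → IsSet a →
                  (∀ w → w ∈ₒ a → Σ[ z ∈ Obj ] R w z) →
                  (∀ w z z' → w ∈ₒ a → R w z → R w z' → z ≡ z') →
                  Σ[ c ∈ Obj ] (IsSet c × (∀ z → (z ∈ₒ c) ⇔ (Σ[ w ∈ Obj ] (w ∈ₒ a × R w z))))

  TF : Obj → Set
  TF x = x ≡ true ⊎ x ≡ false

  TruthOf : Obj → Set → Set
  TruthOf x Q = TF x × ((x ≡ true) ⇔ Q)

record Lang (U : Universe) : Set₁ where
  open Universe U
  field
    V : Set
    C : Set
    F : Set
    #c : C → Obj
    A  : F → List Obj → Set
    P  : F → List Obj → Obj     -- value P_f (relevant where A_f holds)
    ∧ₛ ∨ₛ →ₛ ↔ₛ ¬ₛ ∀ₛ ∃ₛ ∈ₛ =ₛ : F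
    A-∧ : ∀ xs → A ∧ₛ xs ⇔ (Σ[ a ∈ Obj ] Σ[ b ∈ Obj ] (xs ≡ a ∷ b ∷ [] × TF a × TF b))
    P-∧ : ∀ a b → TF a → TF b → TruthOf (P ∧ₛ (a ∷ b ∷ [])) (a ≡ true × b ≡ true)
    A-∨ : ∀ xs → A ∨ₛ xs ⇔ (Σ[ a ∈ Obj ] Σ[ b ∈ Obj ] (xs ≡ a ∷ b ∷ [] × TF a × TF b))
    P-∨ : ∀ a b → TF a → TF b → TruthOf (P ∨ₛ (a ∷ b ∷ [])) (a ≡ true ⊎ b ≡ true)
    A-→ : ∀ xs → A →ₛ xs ⇔ (Σ[ a ∈ Obj ] Σ[ b ∈ Obj ] (xs ≡ a ∷ b ∷ [] × TF a × TF b))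
    P-→ : ∀ a b → TF a → TF b → TruthOf (P →ₛ (a ∷ b ∷ [])) (a ≡ false ⊎ b ≡ true)
    A-↔ : ∀ xs → A ↔ₛ xs ⇔ (Σ[ a ∈ Obj ] Σ[ b ∈ Obj ] (xs ≡ a ∷ b ∷ [] × TF a × TF b))
    P-↔ : ∀ a b → TF a → TF b →
          TruthOf (P ↔ₛ (a ∷ b ∷ [])) ((a ≡ false ⊎ b ≡ true) × (b ≡ false ⊎ a ≡ true))
    A-¬ : ∀ xs → A ¬ₛ xs ⇔ (Σ[ a ∈ Obj ] (xs ≡ a ∷ []))
    P-¬ : ∀ a → TruthOf (P ¬ₛ (a ∷ [])) (a ≡ false)
    A-∀ : ∀ xs → A ∀ₛ xs ⇔ (Σ[ a ∈ Obj ] (xs ≡ a ∷ [] × IsSet a × (∀ z → z ∈ₒ a → TF z)))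
    P-∀ : ∀ a → IsSet a → (∀ z → z ∈ₒ a → TF z) →
          TruthOf (P ∀ₛ (a ∷ [])) (∀ z → z ∈ₒ a → z ≡ true)
    A-∃ : ∀ xs → A ∃ₛ xs ⇔ (Σ[ a ∈ Obj ] (xs ≡ a ∷ [] × IsSet a × (∀ z → z ∈ₒ a → TF z)))
    P-∃ : ∀ a → IsSet a → (∀ z → z ∈ₒ a → TF z) →
          TruthOf (P ∃ₛ (a ∷ [])) (Σ[ z ∈ Obj ] (z ∈ₒ a × z ≡ true))
    A-∈ : ∀ xs → A ∈ₛ xs ⇔ (Σ[ a ∈ Obj ] Σ[ b ∈ Obj ] (xs ≡ a ∷ b ∷ [] × IsSet b))
    P-∈ : ∀ a b → IsSet b → TruthOf (P ∈ₛ (a ∷ b ∷ [])) (a ∈ₒ b)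
    A-= : ∀ xs → A =ₛ xs ⇔ (Σ[ a ∈ Obj ] Σ[ b ∈ Obj ] (xs ≡ a ∷ b ∷ []))
    P-= : ∀ a b → TruthOf (P =ₛ (a ∷ b ∷ [])) (a ≡ b)

module Sem (U : Universe) (L : Lang U) where
  open Universe U
  open Lang L

  -- expressions (abstract syntax of the uniquely readable strings)
  data Expr : Set where
    cst  : C → Expr
    var  : V → Expr
    app  : Expr → List Expr → Expr
    op   : F → List Expr → Expr
    setb : List (V × Expr) → Expr → Expr

  mutual
    _∈Vb_ : V → Expr → Set
    x ∈Vb cst c     = ⊥
    x ∈Vb var y     = ⊥
    x ∈Vb app φ φs  = x ∈Vb φ ⊎ x ∈VbL φs
    x ∈Vb op f φs   = x ∈VbL φs
    x ∈Vb setb bs φ = x ∈ map proj₁ bs ⊎ (x ∈VbB bs ⊎ x ∈Vb φ)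

    _∈VbL_ : V → List Expr → Set
    x ∈VbL []       = ⊥
    x ∈VbL (φ ∷ φs) = x ∈Vb φ ⊎ x ∈VbL φs

    _∈VbB_ : V → List (V × Expr) → Set
    x ∈VbB []             = ⊥
    x ∈VbB ((y , φ) ∷ bs) = x ∈Vb φ ⊎ x ∈VbB bs

  -- soops: contexts k (variable/expression pairs) and assignments σ
  -- (variable/object pairs)
  Ctx : Set
  Ctx = List (V × Expr)

  Soop : Set
  Soop = List (V × Obj)

  dom : ∀ {B : Set} → List (V × B) → List V
  dom = map proj₁

  _⊑_ : Soop → Soop → Set
  σ ⊑ σ' = Σ[ τ ∈ Soop ] (σ' ≡ σ ++ τ)

  Ξε : Soop → Set
  Ξε σ = σ ≡ []

  ΞExt : (Ξ : Soop → Set) → V → ((ρ : Soop) → Ξ ρ → Obj) → Soop → Set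
  ΞExt Ξ y ν σ = Σ[ ρ ∈ Soop ] Σ[ p ∈ Ξ ρ ] Σ[ s ∈ Obj ] (s ∈ₒ ν ρ p × σ ≡ ρ ∷ʳ (y , s))

  Meanings : (Soop → Set) → Set
  Meanings Ξ = (σ : Soop) → Ξ σ → List Obj

  mutual
    -- Ext k Ξ bs Ξ' : starting from the context k ∈ K with assignment
    -- set Ξ = Ξ(k), each successive extension k‖(x₁,φ₁)‖…‖(xᵢ,φᵢ) is
    -- in K (φᵢ ∈ E(previous context), xᵢ not in its domain, meaning a
    -- set for every assignment); Ξ' is Ξ(k‖bs).
    data Ext : Ctx → (Soop → Set) → Ctx → (Soop → Set) → Set₁ where
      done : ∀ {k Ξ} → Ext k Ξ [] Ξ
      step : ∀ {k Ξ y φ bs Ξ'} {ν : (ρ : Soop) → Ξ ρ → Obj} →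
             Den k Ξ φ ν → y ∉ dom k → (∀ ρ p → IsSet (ν ρ p)) →
             Ext (k ∷ʳ (y , φ)) (ΞExt Ξ y ν) bs Ξ' →
             Ext k Ξ ((y , φ) ∷ bs) Ξ'

    -- Den k Ξ t μ : t ∈ E(k), where Ξ = Ξ(k), and μ σ _ = #(k,t,σ)
    -- for σ ∈ Ξ(k).
    data Den : Ctx → (Ξ : Soop → Set) → Expr → ((σ : Soop) → Ξ σ → Obj) → Set₁ where
      dconst : ∀ c → Den [] Ξε (cst c) (λ _ _ → #c c)
      dweak  : ∀ {h Ξ y φ t} {ν : (ρ : Soop) → Ξ ρ → Obj} {μ : (ρ : Soop) → Ξ ρ → Obj} →
               Ext [] Ξε h Ξ → Den h Ξ φ ν → y ∉ dom h → (∀ ρ p → IsSet (ν ρ p)) →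
               Den h Ξ t μ → ¬ (y ∈Vb t) →
               Den (h ∷ʳ (y , φ)) (ΞExt Ξ y ν) t
                   (λ σ q → μ (proj₁ q) (proj₁ (proj₂ q)))
      dvar   : ∀ {h Ξ y φ} {ν : (ρ : Soop) → Ξ ρ → Obj} →
               Ext [] Ξε h Ξ → Den h Ξ φ ν → y ∉ dom h → (∀ ρ p → IsSet (ν ρ p)) →
               Den (h ∷ʳ (y , φ)) (ΞExt Ξ y ν) (var y)
                   (λ σ q → proj₁ (proj₂ (proj₂ q)))
      dapp   : ∀ {k Ξ φ φs} {μ : (σ : Soop) → Ξ σ → Obj} {μs : Meanings Ξ} →
               Ext [] Ξε k Ξ → Den k Ξ φ μ → DenL k Ξ φs μs →
               (∀ σ p → FunDefinedAt (μ σ p) (μs σ p)) →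
               Den k Ξ (app φ φs) (λ σ p → apply (μ σ p) (μs σ p))
      dop    : ∀ {k Ξ f φs} {μs : Meanings Ξ} →
               Ext [] Ξε k Ξ → DenL k Ξ φs μs →
               (∀ σ p → A f (μs σ p)) →
               Den k Ξ (op f φs) (λ σ p → P f (μs σ p))
      dsetb  : ∀ {k Ξ bs Ξ' φ} {ν : (σ : Soop) → Ξ' σ → Obj} {μ : (σ : Soop) → Ξ σ → Obj} →
               Ext [] Ξε k Ξ → Ext k Ξ bs Ξ' → Den (k ++ bs) Ξ' φ ν →
               (∀ σ p → IsSet (μ σ p) ×
                  (∀ z → (z ∈ₒ μ σ p) ⇔
                         (Σ[ σ' ∈ Soop ] Σ[ p' ∈ Ξ' σ' ] (σ ⊑ σ' × ν σ' p' ≡ z)))) →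
               Den k Ξ (setb bs φ) μ

    data DenL : Ctx → (Ξ : Soop → Set) → List Expr → Meanings Ξ → Set₁ where
      dnil  : ∀ {k Ξ} → DenL k Ξ [] (λ _ _ → [])
      dcons : ∀ {k Ξ φ φs} {μ : (σ : Soop) → Ξ σ → Obj} {μs : Meanings Ξ} →
              Den k Ξ φ μ → DenL k Ξ φs μs →
              DenL k Ξ (φ ∷ φs) (λ σ p → μ σ p ∷ μs σ p)

  InK : Ctx → Set₁
  InK k = Σ[ Ξ ∈ (Soop → Set) ] Ext [] Ξε k Ξ

  InS : Ctx → Expr → Set₁
  InS k t = Σ[ Ξ ∈ (Soop → Set) ] Σ[ μ ∈ ((σ : Soop) → Ξ σ → Obj) ]
              (Ext [] Ξε k Ξ × Den k Ξ t μ × (∀ σ p → TF (μ σ p)))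

  MeansTrue : Expr → Set₁
  MeansTrue t = Σ[ μ ∈ ((σ : Soop) → Ξε σ → Obj) ] (Den [] Ξε t μ × μ [] refl ≡ true)

  memExpr : V → Expr → Expr
  memExpr x φ = op ∈ₛ (var x ∷ φ ∷ [])

  -- γ[x₁:φ₁,…,xₘ:φₘ,φ]  (for m ≥ 1; γ[ ,φ] = φ is only an auxiliary base)
  γ : List (V × Expr) → Expr → Expr
  γ []             φ = φ
  γ ((x , ψ) ∷ bs) φ = op ∀ₛ (setb ((x , ψ) ∷ []) (γ bs φ) ∷ [])

module Submission where

-- Call an expression t *valid* in a context k (with assignment
-- set Ξ = Ξ(k)) when t ∈ E(k) and #(k,t,σ) is true for every σ ∈ Ξ(k).
--
--   * In the context k[x₁:φ₁,…,xᵢ:φᵢ] the formula (∈)(xᵢ,φᵢ) is valid: xᵢ is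
--     interpreted by rule (b) as an element s of #(…,φᵢ,ρ), φᵢ by the
--     weakening rule (a) as #(…,φᵢ,ρ) itself, and s ∈ #(…,φᵢ,ρ) holds.
--   * Weakening (a) carries validity of t through any further extension
--     whose variables are not bound in t; this is where xⱼ ∉ V_b(φᵢ), j > i,
--     is used.  Hence (∈)(xᵢ,φᵢ) is valid in k.
--   * Validity of φ in k‖(y,ψ) gives validity of (∀)({}(y:ψ,φ)) in k: the
--     set-builder denotes a set of truths (obtained by separation from
--     {true}), whose ∀ is true.  Iterating along the telescope validates γ.

open import Defs
open import Data.Nat using (ℕ; _≤_; z≤n; s≤s)
open import Data.Fin using (Fin; zero; suc) renaming (_≤_ to _≤ᶠ_)
open import Data.Vec using (Vec; lookup; zip; toList; []; _∷_)
open import Data.Product using (_×_; Σ-syntax; _,_; proj₁; proj₂)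
open import Data.Sum using (inj₁; inj₂)
open import Data.List using (List; []; _∷_; _++_; _∷ʳ_; [_])
open import Data.List.Properties using (++-identityʳ; ++-assoc)
open import Data.List.Membership.Propositional using (_∉_)
open import Data.List.Relation.Unary.All using (All; []; _∷_)
open import Relation.Nullary using (¬_)
open import Relation.Binary.PropositionalEquality using (_≡_; refl; sym; trans; subst)
open import Function.Bundles using (_⇔_; Equivalence; mk⇔)

module _ (U : Universe) (L : Lang U) where
  open Universe U
  open Lang L
  open Sem U L

  -- Meanings are transported along equal contexts (needed because the
  -- telescope k‖b‖bs is built either as (k ∷ʳ b) ++ bs or as k ++ (b ∷ bs)).
  castDen : ∀ {k k' Ξ t μ} → k ≡ k' → Den k Ξ t μ → Den k' Ξ t μ
  castDen eq d = subst (λ c → Den c _ _ _) eq d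

  snoc-++ : ∀ {A : Set} (k : List A) b bs → (k ∷ʳ b) ++ bs ≡ k ++ (b ∷ bs)
  snoc-++ k b bs = ++-assoc k [ b ] bs

  extend : ∀ {k₀ Ξ₀ bs Ξ y φ} {ν : (ρ : Soop) → Ξ ρ → Obj} →
           Ext k₀ Ξ₀ bs Ξ → Den (k₀ ++ bs) Ξ φ ν → y ∉ dom (k₀ ++ bs) →
           (∀ ρ p → IsSet (ν ρ p)) → Ext k₀ Ξ₀ (bs ∷ʳ (y , φ)) (ΞExt Ξ y ν)
  extend {k₀} done d fresh sets =
    step (castDen (++-identityʳ k₀) d)
         (subst (λ c → _ ∉ dom c) (++-identityʳ k₀) fresh) sets done
  extend {k₀} {bs = b ∷ bs} (step d' fresh' sets' e) d fresh sets =
    step d' fresh' sets'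
      (extend e (castDen (sym (snoc-++ k₀ b bs)) d)
                (subst (λ c → _ ∉ dom c) (sym (snoc-++ k₀ b bs)) fresh) sets)

  weaken : ∀ {h Ξh rest Ξ' t} {μ : (σ : Soop) → Ξh σ → Obj} →
           Ext [] Ξε h Ξh → Ext h Ξh rest Ξ' → Den h Ξh t μ →
           All (λ b → ¬ (proj₁ b ∈Vb t)) rest →
           Σ[ ν ∈ ((σ : Soop) → Ξ' σ → Obj) ]
             (Den (h ++ rest) Ξ' t ν ×
              (∀ σ' p' → Σ[ σ ∈ Soop ] Σ[ p ∈ Ξh σ ] (ν σ' p' ≡ μ σ p)))
  weaken {h} pre done dt _ =
    _ , castDen (sym (++-identityʳ h)) dt , λ σ p → σ , p , refl
  weaken {h} {rest = b ∷ rest} pre (step d fresh sets e) dt (b∉t ∷ rest∉t)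
    with weaken (extend pre d fresh sets) e (dweak pre d fresh sets dt b∉t) rest∉t
  ... | ν , dν , restrict =
    ν , castDen (snoc-++ h b rest) dν ,
    λ σ' p' → let (σ , q , eq) = restrict σ' p' in proj₁ q , proj₁ (proj₂ q) , eq

  Valid : Ctx → (Soop → Set) → Expr → Set₁
  Valid k Ξ t = Σ[ μ ∈ ((σ : Soop) → Ξ σ → Obj) ] (Den k Ξ t μ × (∀ σ p → μ σ p ≡ true))

  castValid : ∀ {k k' Ξ t} → k ≡ k' → Valid k Ξ t → Valid k' Ξ t
  castValid eq (μ , d , tr) = μ , castDen eq d , tr

  weakenValid : ∀ {h Ξh rest Ξ' t} → Ext [] Ξε h Ξh → Ext h Ξh rest Ξ' →
                All (λ b → ¬ (proj₁ b ∈Vb t)) rest → Valid h Ξh t → Valid (h ++ rest) Ξ' t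
  weakenValid pre e rest∉t (μ , d , tr) with weaken pre e d rest∉t
  ... | ν , dν , restrict =
    ν , dν , λ σ' p' → let (σ , p , eq) = restrict σ' p' in trans eq (tr σ p)

  ∈-true : ∀ {a b} → IsSet b → a ∈ₒ b → A ∈ₛ (a ∷ b ∷ []) × P ∈ₛ (a ∷ b ∷ []) ≡ true
  ∈-true {a} {b} isSet a∈b =
    Equivalence.from (A-∈ _) (a , b , refl , isSet) ,
    Equivalence.from (proj₂ (P-∈ a b isSet)) a∈b

  ∀-true : ∀ {S} → IsSet S → (∀ z → z ∈ₒ S → z ≡ true) →
           A ∀ₛ (S ∷ []) × P ∀ₛ (S ∷ []) ≡ true
  ∀-true {S} isSet allTrue =
    Equivalence.from (A-∀ _) (S , refl , isSet , tf) ,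
    Equivalence.from (proj₂ (P-∀ S isSet tf)) allTrue
    where
      tf : ∀ z → z ∈ₒ S → TF z
      tf z z∈S = inj₁ (allTrue z z∈S)

  -- Any collection of truths forms a set (by separation from {true}).
  setOfTruths : (Q : Obj → Set) → (∀ z → Q z → z ≡ true) →
                Σ[ S ∈ Obj ] (IsSet S × (∀ z → (z ∈ₒ S) ⇔ Q z))
  setOfTruths Q onlyTrue =
    let (T , isSetT , T-char) = pairing true true
        (S , isSetS , S-char) = separation T Q isSetT
    in S , isSetS , λ z → mk⇔
         (λ z∈S → proj₂ (Equivalence.to (S-char z) z∈S))
         (λ q → Equivalence.from (S-char z)
                  (Equivalence.from (T-char z) (inj₁ (onlyTrue z q)) , q))

  -- A fresh variable y ranging over ψ is a member of ψ: (∈)(y,ψ) is valid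
  -- in h‖(y,ψ), provided y is not bound in ψ (so that ψ can be weakened).
  memberValid : ∀ {h Ξ y ψ} {ν : (ρ : Soop) → Ξ ρ → Obj} →
                Ext [] Ξε h Ξ → Den h Ξ ψ ν → y ∉ dom h → (∀ ρ p → IsSet (ν ρ p)) →
                ¬ (y ∈Vb ψ) → Valid (h ∷ʳ (y , ψ)) (ΞExt Ξ y ν) (memExpr y ψ)
  memberValid {h} {Ξ} {y} {ψ} {ν} pre d fresh sets y∉ψ =
    _ , dop (extend pre d fresh sets) (dcons yDen (dcons ψDen dnil))
            (λ σ q → proj₁ (member σ q)) ,
        (λ σ q → proj₂ (member σ q))
    where
      yDen : Den (h ∷ʳ (y , ψ)) (ΞExt Ξ y ν) (var y) (λ σ q → proj₁ (proj₂ (proj₂ q)))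
      yDen = dvar pre d fresh sets
      ψDen : Den (h ∷ʳ (y , ψ)) (ΞExt Ξ y ν) ψ (λ σ q → ν (proj₁ q) (proj₁ (proj₂ q)))
      ψDen = dweak pre d fresh sets d y∉ψ
      member : ∀ σ (q : ΞExt Ξ y ν σ) →
               let s = proj₁ (proj₂ (proj₂ q)) ; S = ν (proj₁ q) (proj₁ (proj₂ q)) in
               A ∈ₛ (s ∷ S ∷ []) × P ∈ₛ (s ∷ S ∷ []) ≡ true
      member σ (ρ , p , s , s∈ν , _) = ∈-true (sets ρ p) s∈ν

  memberInTelescope :
    ∀ {k Ξ} → Ext [] Ξε k Ξ → ∀ {n} (xs : Vec V n) (φs : Vec Expr n) {Ξ'} →
    Ext k Ξ (toList (zip xs φs)) Ξ' → (i : Fin n) →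
    (∀ j → i ≤ᶠ j → ¬ (lookup xs j ∈Vb lookup φs i)) →
    Valid (k ++ toList (zip xs φs)) Ξ' (memExpr (lookup xs i) (lookup φs i))
  memberInTelescope {k} pre (x ∷ xs) (φ ∷ φs) (step d fresh sets e) zero unbound =
    castValid (snoc-++ k (x , φ) (toList (zip xs φs)))
      (weakenValid (extend pre d fresh sets) e (laterUnbound xs φs (λ j → unbound (suc j) z≤n))
                   (memberValid pre d fresh sets (unbound zero z≤n)))
    where
      notInMem : ∀ {y} → ¬ (y ∈Vb φ) → ¬ (y ∈Vb memExpr x φ)
      notInMem y∉φ (inj₂ (inj₁ y∈φ)) = y∉φ y∈φ
      laterUnbound : ∀ {n} (ys : Vec V n) (ψs : Vec Expr n) → (∀ j → ¬ (lookup ys j ∈Vb φ)) →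
                     All (λ b → ¬ (proj₁ b ∈Vb memExpr x φ)) (toList (zip ys ψs))
      laterUnbound [] [] _ = []
      laterUnbound (y ∷ ys) (ψ ∷ ψs) ys∉φ =
        notInMem (ys∉φ zero) ∷ laterUnbound ys ψs (λ j → ys∉φ (suc j))
  memberInTelescope {k} pre (x ∷ xs) (φ ∷ φs) (step d fresh sets e) (suc i) unbound =
    castValid (snoc-++ k (x , φ) (toList (zip xs φs)))
      (memberInTelescope (extend pre d fresh sets) xs φs e i (λ j i≤j → unbound (suc j) (s≤s i≤j)))

  closeValid : ∀ {k Ξ y ψ φ} {ν : (ρ : Soop) → Ξ ρ → Obj} →
               Ext [] Ξε k Ξ → Den k Ξ ψ ν → y ∉ dom k → (∀ ρ p → IsSet (ν ρ p)) →
               Valid (k ∷ʳ (y , ψ)) (ΞExt Ξ y ν) φ →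
               Valid k Ξ (op ∀ₛ (setb ((y , ψ) ∷ []) φ ∷ []))
  closeValid {k} {Ξ} {y} {ν = ν} pre d fresh sets (μ , dφ , tr) =
    _ , dop pre (dcons (dsetb pre (step d fresh sets done) dφ
                              (λ σ _ → proj₁ (proj₂ (values σ)) , proj₂ (proj₂ (values σ))))
                       dnil)
              (λ σ _ → proj₁ (closed σ)) ,
        (λ σ _ → proj₂ (closed σ))
    where
      -- the values of φ at the extensions of σ: the meaning of {}(y:ψ,φ) at σ
      Value : Soop → Obj → Set
      Value σ z = Σ[ σ' ∈ Soop ] Σ[ p' ∈ ΞExt Ξ y ν σ' ] (σ ⊑ σ' × μ σ' p' ≡ z)
      valueTrue : ∀ σ z → Value σ z → z ≡ true
      valueTrue σ z (σ' , p' , _ , eq) = trans (sym eq) (tr σ' p')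
      values : (σ : Soop) → Σ[ S ∈ Obj ] (IsSet S × (∀ z → (z ∈ₒ S) ⇔ Value σ z))
      values σ = setOfTruths (Value σ) (valueTrue σ)
      closed : (σ : Soop) → A ∀ₛ (proj₁ (values σ) ∷ []) × P ∀ₛ (proj₁ (values σ) ∷ []) ≡ true
      closed σ = let (S , isSet , S-char) = values σ in
        ∀-true isSet (λ z z∈S → valueTrue σ z (Equivalence.to (S-char z) z∈S))

  γValid : ∀ {k Ξ bs Ξ' T} → Ext [] Ξε k Ξ → Ext k Ξ bs Ξ' →
           Valid (k ++ bs) Ξ' T → Valid k Ξ (γ bs T)
  γValid {k} pre done v = castValid (++-identityʳ k) v
  γValid {k} {bs = b ∷ bs} pre (step d fresh sets e) v =
    closeValid pre d fresh sets
      (γValid (extend pre d fresh sets) e (castValid (sym (snoc-++ k b bs)) v))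

  valid⇒InS : ∀ {k Ξ t} → Ext [] Ξε k Ξ → Valid k Ξ t → InS k t
  valid⇒InS e (μ , d , tr) = _ , μ , e , d , λ σ p → inj₁ (tr σ p)

lemma5p16 : (U : Universe) (L : Lang U) →
    let open Sem U L in
    (m : ℕ) → 1 ≤ m →
    (xs : Vec (Lang.V L) m) → (φs : Vec Expr m) →
    (∀ i j → lookup xs i ≡ lookup xs j → i ≡ j) →
    InK (toList (zip xs φs)) →
    (i : Fin m) →
    (∀ j → i ≤ᶠ j → ¬ (lookup xs j ∈Vb lookup φs i)) →
    InS (toList (zip xs φs)) (memExpr (lookup xs i) (lookup φs i))
    × InS [] (γ (toList (zip xs φs)) (memExpr (lookup xs i) (lookup φs i)))
    × MeansTrue (γ (toList (zip xs φs)) (memExpr (lookup xs i) (lookup φs i)))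
lemma5p16 U L m _ xs φs _ (Ξ , k∈K) i unbound =
  valid⇒InS U L k∈K memberValidInK ,
  valid⇒InS U L done closureValid ,
  closureTrue closureValid
  where
    open Sem U L
    k : Ctx
    k = toList (zip xs φs)
    ∈xᵢφᵢ : Expr
    ∈xᵢφᵢ = memExpr (lookup xs i) (lookup φs i)
    memberValidInK : Valid U L k Ξ ∈xᵢφᵢ
    memberValidInK = memberInTelescope U L done xs φs k∈K i unbound
    closureValid : Valid U L [] Ξε (γ k ∈xᵢφᵢ)
    closureValid = γValid U L done k∈K memberValidInK
    closureTrue : ∀ {t} → Valid U L [] Ξε t → MeansTrue t
    closureTrue (μ , d , tr) = μ , d , tr [] refl
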